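{- For $t\in\mathbf{PBT}_n$, any tree $w$ and any $1\le k\le n$, $$\overset{\circledast}{\Delta}(t\circ_k w)=\sum_{i=0}^{k-1}t^i_{(1)}\otimes(t^i_{(2)}\circ_{k-i}w)+\sum(t^k_{(1)}\circ_k\overline w_{(1)})\otimes(t^{k-1}_{(2)}\circ_1\overline w_{(2)})+\sum_{i=k}^n(t^i_{(1)}\circ_k w)\otimes t^i_{(2)},$$ where $\overset{\circledast}{\Delta}(t)=\sum_{i=0}^n t^i_{(1)}\otimes t^i_{(2)}$ with $t^i_{(1)}$ of degree $i$ and $t^i_{(2)}$ of degree $n-i$, $\overset{\circledast}{\Delta}(w)-1_{\mathbb K}\otimes w-w\otimes1_{\mathbb K}=\sum\overline w_{(1)}\otimes\overline w_{(2)}$, and $t\circ_k0=0$.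
   Context: Planar binary rooted trees: every internal vertex has two children; $\mathbf{PBT}_n$ = such trees with $n$ leaves (numbered left to right), $\mathbf{PBT}_1=\{\vert\}$. $t\veebar w$ joins the roots of $t$ (left) and $w$ (right) to a new root; $t\circ_j w$ identifies the root of $w$ with the $j$-th leaf of $t$; extended bilinearly. $\mathcal H=\mathbb K1_{\mathbb K}\oplus\bigoplus_{n\ge1}\mathbb K[\mathbf{PBT}_n]$, graded by number of leaves ($1_{\mathbb K}$ in degree $0$). The coproduct $\overset{\circledast}{\Delta}$ on $\mathcal H$: $\overset{\circledast}{\Delta}(1_{\mathbb K})=1_{\mathbb K}\otimes1_{\mathbb K}$, $\overset{\circledast}{\Delta}(\vert)=1_{\mathbb K}\otimes\vert+\vert\otimes1_{\mathbb K}$, $\overset{\circledast}{\Delta}(t\veebar w)=\sum t_{(1)}\otimes(t_{(2)}\veebar w)+\sum(t\veebar w_{(1)})\otimes w_{(2)}-t\otimes w$ (Sweedler notation; conventions $1_{\mathbb K}\veebar w=w$, $t\veebar1_{\mathbb K}=t$). For a tree $t$ with $n$ leaves, $\overset{\circledast}{\Delta}(t)$ has exactly one term in each bidegree $(i,n-i)$, $0\le i\le n$, with $t^0_{(1)}=1_{\mathbb K}=t^n_{(2)}$, $t^n_{(1)}=t=t^0_{(2)}$. -}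

module Defs where

open import Level using (Level)
open import Data.Nat using (ℕ; zero; suc; _+_; _∸_; _≤?_)
open import Data.Maybe using (Maybe; nothing; just)
open import Data.Product using (_×_; _,_)
open import Data.List using (List; []; _∷_; _++_; map; concatMap; upTo; foldr)
open import Relation.Nullary using (yes; no)
open import Relation.Binary.PropositionalEquality using (_≡_; refl; cong₂)
open import Relation.Binary.Definitions using (DecidableEquality)
open import Algebra.Bundles using (CommutativeRing)

-- Planar binary rooted trees.  leaf = the tree | ; node t w = t ∨ w.
data PBT : Set where
  leaf : PBT
  node : PBT → PBT → PBT

leaves : PBT → ℕ
leaves leaf       = 1
leaves (node t w) = leaves t + leaves w

-- t ∘_j w : graft the root of w onto the j-th leaf of t (leaves numbered 1..n
-- from left to right).  For j outside 1..leaves t the value is irrelevant junk.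
graft : PBT → ℕ → PBT → PBT
graft leaf       _ w = w
graft (node l r) j w with j ≤? leaves l
... | yes _ = node (graft l j w) r
... | no  _ = node l (graft r (j ∸ leaves l) w)

_≟T_ : DecidableEquality PBT
leaf ≟T leaf = yes refl
leaf ≟T node _ _ = no λ ()
node _ _ ≟T leaf = no λ ()
node a b ≟T node c d with a ≟T c | b ≟T d
... | yes refl | yes refl = yes refl
... | no p | _ = no λ { refl → p refl }
... | _ | no q = no λ { refl → q refl }

-- Basis of H: nothing = 1_K (degree 0), just t = the tree t.
Basis : Set
Basis = Maybe PBT

deg : Basis → ℕ
deg nothing  = 0
deg (just t) = leaves t

_≟B_ : DecidableEquality Basis
nothing ≟B nothing = yes refl
nothing ≟B just _ = no λ ()
just _ ≟B nothing = no λ ()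
just a ≟B just b with a ≟T b
... | yes refl = yes refl
... | no p = no λ { refl → p refl }

Basis² : Set
Basis² = Basis × Basis

_≟B²_ : DecidableEquality Basis²
(a , b) ≟B² (c , d) with a ≟B c | b ≟B d
... | yes refl | yes refl = yes refl
... | no p | _ = no λ { refl → p refl }
... | _ | no q = no λ { refl → q refl }

vee : Basis → Basis → Basis
vee nothing  w        = w
vee (just t) nothing  = just t
vee (just t) (just w) = just (node t w)

-- t ∘_j w on basis elements.  Only applied (with nonzero net coefficient) to
-- trees; the values involving 1_K are arbitrary fixed junk.
comp : Basis → ℕ → Basis → Basis
comp (just t) j (just w) = just (graft t j w)
comp x        _ _        = x

module Over {c ℓ : Level} (R : CommutativeRing c ℓ) where
  open CommutativeRing R renaming (Carrier to K; _+_ to _+K_; _*_ to _*K_)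

  -- Formal finite linear combinations of elements of a basis B.
  Lin : Set → Set c
  Lin B = List (K × B)

  coeff : {B : Set} → DecidableEquality B → B → Lin B → K
  coeff _≟_ b []             = 0#
  coeff _≟_ b ((k , x) ∷ xs) with x ≟ b
  ... | yes _ = k +K coeff _≟_ b xs
  ... | no  _ = coeff _≟_ b xs

  _≋_ : Lin Basis² → Lin Basis² → Set ℓ
  xs ≋ ys = ∀ b → coeff _≟B²_ b xs ≈ coeff _≟B²_ b ys

  Δ⊛T : PBT → Lin Basis²
  Δ⊛T leaf = (1# , (nothing , just leaf)) ∷ (1# , (just leaf , nothing)) ∷ []
  Δ⊛T (node t w) =
       map (λ { (k , (x , y)) → (k , (x , vee y (just w))) }) (Δ⊛T t)
    ++ map (λ { (k , (x , y)) → (k , (vee (just t) x , y)) }) (Δ⊛T w)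
    ++ ((- 1#) , (just t , just w)) ∷ []

  Δ⊛ : Basis → Lin Basis²
  Δ⊛ nothing  = (1# , (nothing , nothing)) ∷ []
  Δ⊛ (just t) = Δ⊛T t

  Δ⊛bar : PBT → Lin Basis²
  Δ⊛bar w = Δ⊛T w ++ ((- 1#) , (nothing , just w)) ∷ ((- 1#) , (just w , nothing)) ∷ []

  [_⊗_] : Basis → Basis → Lin Basis²
  [ x ⊗ y ] = (1# , (x , y)) ∷ []

  -- Σ_{i=lo}^{hi} f i   (empty if hi < lo)
  Σ[_≤i≤_] : ℕ → ℕ → (ℕ → Lin Basis²) → Lin Basis²
  Σ[ lo ≤i≤ hi ] f = concatMap f (map (lo +_) (upTo (suc hi ∸ lo)))

  compBoth : Basis → ℕ → Basis → ℕ → Lin Basis² → Lin Basis²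
  compBoth a j b l = map (λ { (k , (x , y)) → (k , (comp a j x , comp b l y)) })

{-# OPTIONS --safe #-}
-- Write Δ⊛ t = Σᵢ t⁽ⁱ⁾₍₁₎ ⊗ t⁽ⁱ⁾₍₂₎ with the components computed explicitly from the recursion
-- for Δ⊛.  For t = l ∨ r,
-- grafting into l commutes with x ⊗ y ↦ x ⊗ (y ∨ r) and grafting into r commutes with
-- x ⊗ y ↦ (l ∨ x) ⊗ y; in both cases the correction term - u ⊗ v of Δ⊛(u ∨ v) cancels the
-- image of the first term 1 ⊗ v of Δ⊛ v.  Formal sums are compared up to reordering and
-- cancellation, which is preserved by any map on basis elements.  Finally, the components
-- have pairwise distinct bidegrees, so the given expansion Σ a i ⊗ b i of Δ⊛ t is the
-- canonical one, unless 1 = 0 in K, where every equation holds.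
module Submission where

open import Defs
open import Level using (Level)
open import Function using (_∘_; case_of_)
open import Data.Nat using (ℕ; zero; suc; _+_; _∸_; _≤_; _<_; _≤?_; z≤n; s≤s; s≤s⁻¹; z<s; s<s)
open import Data.Nat.Properties
open import Data.Maybe using (nothing; just)
open import Data.Product using (_,_; proj₁; proj₂; map₂; ∃-syntax)
open import Data.Sum using (_⊎_; inj₁; inj₂; [_,_]′)
open import Data.List using (List; []; _∷_; _++_; map; concat; applyUpTo)
open import Data.List.Properties
  using (map-++; ++-assoc; ++-identityʳ; map-applyUpTo; concat-map; map-∘; map-cong)
open import Relation.Nullary using (yes; no)
open import Relation.Nullary.Negation using (contradiction)
open import Relation.Binary.PropositionalEquality
open import Algebra.Bundles using (CommutativeRing)
open import Relation.Binary.Bundles using (Setoid)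
open import Relation.Binary.Definitions using (DecidableEquality)
import Relation.Binary.Reasoning.Setoid as SetoidReasoning

module _ {a} {A : Set a} where

  concatUpTo : ℕ → (ℕ → List A) → List A
  concatUpTo m f = concat (applyUpTo f m)

  concatUpTo-cong : ∀ m {f g : ℕ → List A} → (∀ j → j < m → f j ≡ g j) →
                    concatUpTo m f ≡ concatUpTo m g
  concatUpTo-cong zero    f≡g = refl
  concatUpTo-cong (suc m) f≡g =
    cong₂ _++_ (f≡g 0 z<s) (concatUpTo-cong m (λ j j<m → f≡g (suc j) (s<s j<m)))

  concatUpTo-+ : ∀ m n (f : ℕ → List A) →
                 concatUpTo (m + n) f ≡ concatUpTo m f ++ concatUpTo n (f ∘ (m +_))
  concatUpTo-+ zero    n f = refl
  concatUpTo-+ (suc m) n f = begin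
    f 0 ++ concatUpTo (m + n) (f ∘ suc)
      ≡⟨ cong (f 0 ++_) (concatUpTo-+ m n (f ∘ suc)) ⟩
    f 0 ++ (concatUpTo m (f ∘ suc) ++ concatUpTo n (f ∘ (suc m +_)))
      ≡⟨ ++-assoc (f 0) _ _ ⟨
    concatUpTo (suc m) f ++ concatUpTo n (f ∘ (suc m +_)) ∎
    where open ≡-Reasoning

  concatUpTo-suc : ∀ m (f : ℕ → List A) → concatUpTo (suc m) f ≡ concatUpTo m f ++ f m
  concatUpTo-suc zero    f = ++-identityʳ (f 0)
  concatUpTo-suc (suc m) f =
    trans (cong (f 0 ++_) (concatUpTo-suc m (f ∘ suc))) (sym (++-assoc (f 0) _ _))

map-concatUpTo : ∀ {a b} {A : Set a} {B : Set b} (h : A → B) m (f : ℕ → List A) →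
                 map h (concatUpTo m f) ≡ concatUpTo m (map h ∘ f)
map-concatUpTo h m f =
  trans (sym (concat-map {f = h} (applyUpTo f m))) (cong concat (map-applyUpTo f (map h) m))

map-++₃ : ∀ {a b} {A : Set a} {B : Set b} (f : A → B) xs ys zs →
          map f (xs ++ ys ++ zs) ≡ map f xs ++ map f ys ++ map f zs
map-++₃ f xs ys zs = trans (map-++ f xs (ys ++ zs)) (cong (map f xs ++_) (map-++ f ys zs))

all-or-⊎ : ∀ {p q} {P : ℕ → Set p} {Q : Set q} n →
           (∀ i → i ≤ n → P i ⊎ Q) → (∀ i → i ≤ n → P i) ⊎ Q
all-or-⊎ zero    h with h 0 z≤n
... | inj₁ p0 = inj₁ λ { zero _ → p0 }
... | inj₂ q  = inj₂ q
all-or-⊎ {P = P} (suc n) h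
  with h 0 z≤n | all-or-⊎ {P = P ∘ suc} n (λ i i≤n → h (suc i) (s≤s i≤n))
... | inj₂ q  | _       = inj₂ q
... | inj₁ _  | inj₂ q  = inj₂ q
... | inj₁ p0 | inj₁ ps = inj₁ λ { zero _ → p0 ; (suc i) (s≤s i≤n) → ps i i≤n }

≤⊎≡+suc : ∀ k n → k ≤ n ⊎ ∃[ j ] k ≡ n + suc j
≤⊎≡+suc k n with k ≤? n
... | yes k≤n = inj₁ k≤n
... | no  k≰n = inj₂ (k ∸ suc n , trans (sym (m+[n∸m]≡n (≰⇒> k≰n))) (sym (+-suc n _)))

k+j≤n : ∀ {k n j} → k ≤ suc n → j < suc n ∸ k → k + j ≤ n
k+j≤n {k} {n} {j} k≤1+n j<1+n∸k =
  s≤s⁻¹ (subst (k + j <_) (m+[n∸m]≡n k≤1+n) (+-monoʳ-< k j<1+n∸k))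

m+[n∸m+o]≡n+o : ∀ {m n} o → m ≤ n → m + (n ∸ m + o) ≡ n + o
m+[n∸m+o]≡n+o {m} {n} o m≤n =
  trans (sym (+-assoc m (n ∸ m) o)) (cong (_+ o) (m+[n∸m]≡n m≤n))

0<leaves : ∀ t → 0 < leaves t
0<leaves leaf       = z<s
0<leaves (node l r) = ≤-trans (0<leaves l) (m≤m+n (leaves l) (leaves r))

graft-node-≤ : ∀ {l r j} w → j ≤ leaves l → graft (node l r) j w ≡ node (graft l j w) r
graft-node-≤ {l} {r} {j} w j≤l with j ≤? leaves l
... | yes _   = refl
... | no  j≰l = contradiction j≤l j≰l

graft-node-+ : ∀ l r j w → graft (node l r) (leaves l + suc j) w ≡ node l (graft r (suc j) w)
graft-node-+ l r j w with leaves l + suc j ≤? leaves l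
... | yes l+j≤l = contradiction l+j≤l (m+1+n≰m (leaves l))
... | no  _     = cong (λ i → node l (graft r i w)) (m+n∸m≡n (leaves l) (suc j))

deg-vee : ∀ x y → deg (vee x y) ≡ deg x + deg y
deg-vee nothing  y        = refl
deg-vee (just t) nothing  = sym (+-identityʳ (leaves t))
deg-vee (just t) (just u) = refl

comp-leaf : ∀ {x} → 0 < deg x → comp (just leaf) 1 x ≡ x
comp-leaf {just _} _ = refl

comp-veeʳ-≤ : ∀ {y j} r v → 0 < deg y → j ≤ deg y →
              comp (vee y (just r)) j v ≡ vee (comp y j v) (just r)
comp-veeʳ-≤ {just y} r nothing  _ _   = refl
comp-veeʳ-≤ {just y} r (just w) _ j≤y = cong just (graft-node-≤ w j≤y)

comp-veeʳ-+ : ∀ y r j w →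
              comp (vee y (just r)) (deg y + suc j) (just w) ≡ vee y (just (graft r (suc j) w))
comp-veeʳ-+ nothing  r j w = refl
comp-veeʳ-+ (just y) r j w = cong just (graft-node-+ y r j w)

comp-veeˡ-≤ : ∀ l {x j} w → 0 < deg x → j ≤ leaves l →
              comp (vee (just l) x) j (just w) ≡ vee (just (graft l j w)) x
comp-veeˡ-≤ l {just x} w _ j≤l = cong just (graft-node-≤ w j≤l)

comp-veeˡ-+ : ∀ l {x} j v → 0 < deg x →
              comp (vee (just l) x) (leaves l + suc j) v ≡ vee (just l) (comp x (suc j) v)
comp-veeˡ-+ l {just x} j nothing  _ = refl
comp-veeˡ-+ l {just x} j (just w) _ = cong just (graft-node-+ l x j w)

joinʳ : PBT → Basis² → Basis²
joinʳ r (x , y) = x , vee y (just r)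

joinˡ : PBT → Basis² → Basis²
joinˡ l (x , y) = vee (just l) x , y

graft₁ : ℕ → PBT → Basis² → Basis²
graft₁ j w (x , y) = comp x j (just w) , y

graft₂ : ℕ → PBT → Basis² → Basis²
graft₂ j w (x , y) = x , comp y j (just w)

-- component t i = (t⁽ⁱ⁾₍₁₎ , t⁽ⁱ⁾₍₂₎).  In Δ⊛(l ∨ r) both sums contribute l ⊗ r at
-- i = leaves l; one copy cancels the correction term - l ⊗ r.
component : PBT → ℕ → Basis²
component leaf       zero    = nothing , just leaf
component leaf       (suc _) = just leaf , nothing
component (node l r) i with i ≤? leaves l
... | yes _ = joinʳ r (component l i)
... | no  _ = joinˡ l (component r (i ∸ leaves l))

component-zero : ∀ t → component t 0 ≡ (nothing , just t)
component-zero leaf       = refl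
component-zero (node l r) = cong (joinʳ r) (component-zero l)

component-leaves : ∀ t → component t (leaves t) ≡ (just t , nothing)
component-leaves leaf = refl
component-leaves (node l r) with leaves l + leaves r ≤? leaves l
... | yes n≤l = contradiction n≤l (<⇒≱ (m<m+n (leaves l) (0<leaves r)))
... | no  _   = cong (joinˡ l)
  (trans (cong (component r) (m+n∸m≡n (leaves l) (leaves r))) (component-leaves r))

component-node-≤ : ∀ {l} r {i} → i ≤ leaves l →
                   component (node l r) i ≡ joinʳ r (component l i)
component-node-≤ {l} r {i} i≤l with i ≤? leaves l
... | yes _   = refl
... | no  i≰l = contradiction i≤l i≰l

component-node-+ : ∀ l r j → component (node l r) (leaves l + j) ≡ joinˡ l (component r j)
component-node-+ l r zero = begin
  component (node l r) (leaves l + 0)  ≡⟨ cong (component (node l r)) (+-identityʳ (leaves l)) ⟩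
  component (node l r) (leaves l)      ≡⟨ component-node-≤ r ≤-refl ⟩
  joinʳ r (component l (leaves l))     ≡⟨ cong (joinʳ r) (component-leaves l) ⟩
  joinˡ l (nothing , just r)           ≡⟨ cong (joinˡ l) (component-zero r) ⟨
  joinˡ l (component r 0)              ∎
  where open ≡-Reasoning
component-node-+ l r (suc j) with leaves l + suc j ≤? leaves l
... | yes l+j≤l = contradiction l+j≤l (m+1+n≰m (leaves l))
... | no  _     = cong (joinˡ l ∘ component r) (m+n∸m≡n (leaves l) (suc j))

deg-component₁ : ∀ t {i} → i ≤ leaves t → deg (proj₁ (component t i)) ≡ i
deg-component₁ leaf       {zero}        _ = refl
deg-component₁ leaf       {suc zero}    _ = refl
deg-component₁ leaf       {suc (suc _)} (s≤s ())
deg-component₁ (node l r) {i} i≤n with i ≤? leaves l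
... | yes i≤l = deg-component₁ l i≤l
... | no  i≰l = begin
  deg (vee (just l) (proj₁ (component r (i ∸ leaves l))))
    ≡⟨ deg-vee (just l) (proj₁ (component r (i ∸ leaves l))) ⟩
  leaves l + deg (proj₁ (component r (i ∸ leaves l)))
    ≡⟨ cong (leaves l +_) (deg-component₁ r (m≤n+o⇒m∸n≤o i (leaves l) i≤n)) ⟩
  leaves l + (i ∸ leaves l)
    ≡⟨ m+[n∸m]≡n (<⇒≤ (≰⇒> i≰l)) ⟩
  i ∎
  where open ≡-Reasoning

deg-component-+ : ∀ t i → deg (proj₁ (component t i)) + deg (proj₂ (component t i)) ≡ leaves t
deg-component-+ leaf       zero    = refl
deg-component-+ leaf       (suc _) = refl
deg-component-+ (node l r) i with i ≤? leaves l
... | yes _ = let (x , y) = component l i in begin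
  deg x + deg (vee y (just r))  ≡⟨ cong (deg x +_) (deg-vee y (just r)) ⟩
  deg x + (deg y + leaves r)    ≡⟨ +-assoc (deg x) (deg y) (leaves r) ⟨
  deg x + deg y + leaves r      ≡⟨ cong (_+ leaves r) (deg-component-+ l i) ⟩
  leaves l + leaves r           ∎
  where open ≡-Reasoning
... | no  _ = let (x , y) = component r (i ∸ leaves l) in begin
  deg (vee (just l) x) + deg y  ≡⟨ cong (_+ deg y) (deg-vee (just l) x) ⟩
  leaves l + deg x + deg y      ≡⟨ +-assoc (leaves l) (deg x) (deg y) ⟩
  leaves l + (deg x + deg y)    ≡⟨ cong (leaves l +_) (deg-component-+ r (i ∸ leaves l)) ⟩
  leaves l + leaves r           ∎
  where open ≡-Reasoning

deg-component₂ : ∀ t {i} → i ≤ leaves t → deg (proj₂ (component t i)) ≡ leaves t ∸ i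
deg-component₂ t {i} i≤n = let (x , y) = component t i in begin
  deg y                    ≡⟨ m+n∸m≡n (deg x) (deg y) ⟨
  deg x + deg y ∸ deg x    ≡⟨ cong₂ _∸_ (deg-component-+ t i) (deg-component₁ t i≤n) ⟩
  leaves t ∸ i             ∎
  where open ≡-Reasoning

component₁-tree : ∀ t {i} → 0 < i → i ≤ leaves t → 0 < deg (proj₁ (component t i))
component₁-tree t 0<i i≤n = subst (0 <_) (sym (deg-component₁ t i≤n)) 0<i

component₂-tree : ∀ t {i} → i < leaves t → 0 < deg (proj₂ (component t i))
component₂-tree t i<n = subst (0 <_) (sym (deg-component₂ t (<⇒≤ i<n))) (m<n⇒0<n∸m i<n)

module FormalSums {c ℓ : Level} (R : CommutativeRing c ℓ) where

  open module K = CommutativeRing R using (_≈_; 0#; 1#; -_) renaming (_+_ to _+ᴷ_)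
  open Over R using (Lin; coeff)

  ⟨_⟩ : {B : Set} → B → Lin B
  ⟨ p ⟩ = (1# , p) ∷ []

  mapTerms : {A B : Set} → (A → B) → Lin A → Lin B
  mapTerms h = map (map₂ h)

  mapTerms-concatUpTo : ∀ {A B : Set} (h : A → B) m {F : ℕ → A} {G : ℕ → B} →
                        (∀ j → j < m → h (F j) ≡ G j) →
                        mapTerms h (concatUpTo m (⟨_⟩ ∘ F)) ≡ concatUpTo m (⟨_⟩ ∘ G)
  mapTerms-concatUpTo h m hF≡G =
    trans (map-concatUpTo (map₂ h) m _) (concatUpTo-cong m (λ j j<m → cong ⟨_⟩ (hF≡G j j<m)))

  -- Unlike coefficientwise equality _≋_, this relation is evidently preserved by mapTerms.
  infix 4 _∼_
  data _∼_ {B : Set} : Lin B → Lin B → Set c where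
    ∼-refl  : ∀ {xs} → xs ∼ xs
    ∼-sym   : ∀ {xs ys} → xs ∼ ys → ys ∼ xs
    ∼-trans : ∀ {xs ys zs} → xs ∼ ys → ys ∼ zs → xs ∼ zs
    ++⁺     : ∀ {xs xs′ ys ys′} → xs ∼ xs′ → ys ∼ ys′ → xs ++ ys ∼ xs′ ++ ys′
    ++-comm : ∀ xs ys → xs ++ ys ∼ ys ++ xs
    cancel  : ∀ p → (1# , p) ∷ (- 1# , p) ∷ [] ∼ []

  ≡⇒∼ : ∀ {B : Set} {xs ys : Lin B} → xs ≡ ys → xs ∼ ys
  ≡⇒∼ refl = ∼-refl

  ∼-setoid : Set → Setoid c c
  ∼-setoid B = record
    { Carrier       = Lin B
    ; _≈_           = _∼_
    ; isEquivalence = record { refl = ∼-refl ; sym = ∼-sym ; trans = ∼-trans }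
    }

  module ∼-Reasoning {B : Set} = SetoidReasoning (∼-setoid B)

  mapTerms⁺ : ∀ {A B : Set} (h : A → B) {xs ys} → xs ∼ ys → mapTerms h xs ∼ mapTerms h ys
  mapTerms⁺ h ∼-refl        = ∼-refl
  mapTerms⁺ h (∼-sym e)     = ∼-sym (mapTerms⁺ h e)
  mapTerms⁺ h (∼-trans e f) = ∼-trans (mapTerms⁺ h e) (mapTerms⁺ h f)
  mapTerms⁺ h (++⁺ {xs} {xs′} {ys} {ys′} e f)
    rewrite map-++ (map₂ h) xs ys | map-++ (map₂ h) xs′ ys′ = ++⁺ (mapTerms⁺ h e) (mapTerms⁺ h f)
  mapTerms⁺ h (++-comm xs ys)
    rewrite map-++ (map₂ h) xs ys | map-++ (map₂ h) ys xs = ++-comm (mapTerms h xs) (mapTerms h ys)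
  mapTerms⁺ h (cancel p)    = cancel (h p)

  ++-cancel : ∀ {B : Set} (p : B) xs ys → ((1# , p) ∷ xs) ++ ((- 1# , p) ∷ ys) ∼ xs ++ ys
  ++-cancel p xs ys = begin
    ⟨ p ⟩ ++ (xs ++ (- 1# , p) ∷ ys)         ≈⟨ ++⁺ {xs = ⟨ p ⟩} ∼-refl (++-comm xs ((- 1# , p) ∷ ys)) ⟩
    ((1# , p) ∷ (- 1# , p) ∷ []) ++ ys ++ xs  ≈⟨ ++⁺ {ys = ys ++ xs} (cancel p) ∼-refl ⟩
    ys ++ xs                                 ≈⟨ ++-comm ys xs ⟩
    xs ++ ys                                 ∎
    where open ∼-Reasoning

  module _ {B : Set} (_≟_ : DecidableEquality B) where

    coeff-≡ : ∀ {x b} k xs → x ≡ b → coeff _≟_ b ((k , x) ∷ xs) ≈ k +ᴷ coeff _≟_ b xs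
    coeff-≡ {x} {b} k xs x≡b with x ≟ b
    ... | yes _   = K.refl
    ... | no  x≢b = contradiction x≡b x≢b

    coeff-≢ : ∀ {x b} k xs → x ≢ b → coeff _≟_ b ((k , x) ∷ xs) ≈ coeff _≟_ b xs
    coeff-≢ {x} {b} k xs x≢b with x ≟ b
    ... | yes x≡b = contradiction x≡b x≢b
    ... | no  _   = K.refl

    coeff-++ : ∀ b xs ys → coeff _≟_ b (xs ++ ys) ≈ coeff _≟_ b xs +ᴷ coeff _≟_ b ys
    coeff-++ b []             ys = K.sym (K.+-identityˡ _)
    coeff-++ b ((k , x) ∷ xs) ys with x ≟ b
    ... | yes _ = K.trans (K.+-cong K.refl (coeff-++ b xs ys)) (K.sym (K.+-assoc k _ _))
    ... | no  _ = coeff-++ b xs ys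

    coeff-cancel : ∀ p b → coeff _≟_ b ((1# , p) ∷ (- 1# , p) ∷ []) ≈ 0#
    -- Not `with p ≟ b`: that would also abstract the test hidden in the second cons cell.
    coeff-cancel p b = case p ≟ b of λ where
      (no p≢b)  → K.trans (coeff-≢ _ _ p≢b) (coeff-≢ _ _ p≢b)
      (yes p≡b) → let open SetoidReasoning K.setoid in begin
        coeff _≟_ b ((1# , p) ∷ (- 1# , p) ∷ []) ≈⟨ coeff-≡ 1# _ p≡b ⟩
        1# +ᴷ coeff _≟_ b ((- 1# , p) ∷ [])       ≈⟨ K.+-cong K.refl (coeff-≡ (- 1#) [] p≡b) ⟩
        1# +ᴷ (- 1# +ᴷ 0#)                       ≈⟨ K.+-cong K.refl (K.+-identityʳ (- 1#)) ⟩
        1# +ᴷ - 1#                               ≈⟨ K.-‿inverseʳ 1# ⟩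
        0#                                       ∎

    ∼⇒coeff≈ : ∀ {xs ys} → xs ∼ ys → ∀ b → coeff _≟_ b xs ≈ coeff _≟_ b ys
    ∼⇒coeff≈ ∼-refl        b = K.refl
    ∼⇒coeff≈ (∼-sym e)     b = K.sym (∼⇒coeff≈ e b)
    ∼⇒coeff≈ (∼-trans e f) b = K.trans (∼⇒coeff≈ e b) (∼⇒coeff≈ f b)
    ∼⇒coeff≈ (++⁺ {xs} {xs′} {ys} {ys′} e f) b = K.trans (coeff-++ b xs ys)
      (K.trans (K.+-cong (∼⇒coeff≈ e b) (∼⇒coeff≈ f b)) (K.sym (coeff-++ b xs′ ys′)))
    ∼⇒coeff≈ (++-comm xs ys) b =
      K.trans (coeff-++ b xs ys) (K.trans (K.+-comm _ _) (K.sym (coeff-++ b ys xs)))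
    ∼⇒coeff≈ (cancel p)    b = coeff-cancel p b

    coeff-concatUpTo-∉ : ∀ m (F : ℕ → B) {b} → (∀ j → j < m → F j ≢ b) →
                         coeff _≟_ b (concatUpTo m (⟨_⟩ ∘ F)) ≈ 0#
    coeff-concatUpTo-∉ zero    F F≢b = K.refl
    coeff-concatUpTo-∉ (suc m) F F≢b = K.trans (coeff-≢ 1# _ (F≢b 0 z<s))
      (coeff-concatUpTo-∉ m (F ∘ suc) (λ j j<m → F≢b (suc j) (s<s j<m)))

    coeff-concatUpTo-unique : ∀ m (F : ℕ → B) {i b} → i < m → F i ≡ b →
                              (∀ j → j < m → F j ≡ b → j ≡ i) →
                              coeff _≟_ b (concatUpTo m (⟨_⟩ ∘ F)) ≈ 1#
    coeff-concatUpTo-unique (suc m) F {zero} _ F0≡b only-i = K.trans (coeff-≡ 1# _ F0≡b)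
      (K.trans (K.+-cong K.refl (coeff-concatUpTo-∉ m (F ∘ suc)
                  (λ j j<m Fj≡b → 1+n≢0 (only-i (suc j) (s<s j<m) Fj≡b))))
               (K.+-identityʳ 1#))
    coeff-concatUpTo-unique (suc m) F {suc i} (s<s i<m) Fi≡b only-i = K.trans
      (coeff-≢ 1# _ (λ F0≡b → 0≢1+n (only-i 0 z<s F0≡b)))
      (coeff-concatUpTo-unique m (F ∘ suc) i<m Fi≡b
        (λ j j<m Fj≡b → suc-injective (only-i (suc j) (s<s j<m) Fj≡b)))

  1≈0⇒≈ : 1# ≈ 0# → ∀ x y → x ≈ y
  1≈0⇒≈ 1≈0 x y = K.trans (≈0 x) (K.sym (≈0 y))
    where
    ≈0 : ∀ x → x ≈ 0#
    ≈0 x = begin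
      x          ≈⟨ K.*-identityʳ x ⟨
      x K.* 1#   ≈⟨ K.*-cong K.refl 1≈0 ⟩
      x K.* 0#   ≈⟨ K.zeroʳ x ⟩
      0#         ∎
      where open SetoidReasoning K.setoid

module GraftCoproduct {c ℓ : Level} (R : CommutativeRing c ℓ) where

  open CommutativeRing R using (_≈_; 0#; 1#; -_)
  open Over R
  open FormalSums R

  ∼⇒≋ : ∀ {xs ys} → xs ∼ ys → xs ≋ ys
  ∼⇒≋ = ∼⇒coeff≈ _≟B²_

  Δ⊛T-node : ∀ {u v A B} → Δ⊛T u ∼ A → Δ⊛T v ∼ ⟨ nothing , just v ⟩ ++ B →
             Δ⊛T (node u v) ∼ mapTerms (joinʳ v) A ++ mapTerms (joinˡ u) B
  Δ⊛T-node {u} {v} {A} {B} Δu∼A Δv∼B = begin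
    mapTerms (joinʳ v) (Δ⊛T u) ++ mapTerms (joinˡ u) (Δ⊛T v) ++ (- 1# , uv) ∷ []
      ≈⟨ ++⁺ (mapTerms⁺ (joinʳ v) Δu∼A) (++⁺ (mapTerms⁺ (joinˡ u) Δv∼B) ∼-refl) ⟩
    mapTerms (joinʳ v) A ++ ((1# , uv) ∷ mapTerms (joinˡ u) B) ++ (- 1# , uv) ∷ []
      ≈⟨ ++⁺ ∼-refl (++-cancel uv (mapTerms (joinˡ u) B) []) ⟩
    mapTerms (joinʳ v) A ++ mapTerms (joinˡ u) B ++ []
      ≡⟨ cong (mapTerms (joinʳ v) A ++_) (++-identityʳ _) ⟩
    mapTerms (joinʳ v) A ++ mapTerms (joinˡ u) B ∎
    where
    open ∼-Reasoning
    uv = just u , just v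

  expansion : PBT → Lin Basis²
  expansion t = concatUpTo (suc (leaves t)) (⟨_⟩ ∘ component t)

  expansion-head : ∀ t →
    expansion t ≡ ⟨ nothing , just t ⟩ ++ concatUpTo (leaves t) (⟨_⟩ ∘ component t ∘ suc)
  expansion-head t =
    cong (λ p → ⟨ p ⟩ ++ concatUpTo (leaves t) (⟨_⟩ ∘ component t ∘ suc)) (component-zero t)

  component-node-suc : ∀ l r j →
    component (node l r) (suc (leaves l + j)) ≡ joinˡ l (component r (suc j))
  component-node-suc l r j =
    trans (cong (component (node l r)) (sym (+-suc (leaves l) j))) (component-node-+ l r (suc j))

  Δ⊛T-expansion : ∀ t → Δ⊛T t ∼ expansion t
  Δ⊛T-expansion leaf       = ∼-refl
  Δ⊛T-expansion (node l r) = begin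
    Δ⊛T (node l r)
      ≈⟨ Δ⊛T-node (Δ⊛T-expansion l) (∼-trans (Δ⊛T-expansion r) (≡⇒∼ (expansion-head r))) ⟩
    mapTerms (joinʳ r) (expansion l) ++ mapTerms (joinˡ l) (concatUpTo M (⟨_⟩ ∘ component r ∘ suc))
      ≡⟨ cong₂ _++_
           (mapTerms-concatUpTo (joinʳ r) (suc L) {G = component t}
             (λ i i≤L → sym (component-node-≤ r (s≤s⁻¹ i≤L))))
           (mapTerms-concatUpTo (joinˡ l) M {G = component t ∘ (suc L +_)}
             (λ j _ → sym (component-node-suc l r j))) ⟩
    concatUpTo (suc L) (⟨_⟩ ∘ component t) ++ concatUpTo M (⟨_⟩ ∘ component t ∘ (suc L +_))
      ≡⟨ concatUpTo-+ (suc L) M (⟨_⟩ ∘ component t) ⟨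
    expansion t ∎
    where
    open ∼-Reasoning
    t = node l r
    L = leaves l
    M = leaves r

  interior : PBT → Lin Basis²
  interior t = concatUpTo (leaves t ∸ 1) (⟨_⟩ ∘ component t ∘ suc)

  expansion-split : ∀ t →
    expansion t ≡ ⟨ nothing , just t ⟩ ++ interior t ++ ⟨ just t , nothing ⟩
  expansion-split t = begin
    expansion t
      ≡⟨ expansion-head t ⟩
    ⟨ ∅t ⟩ ++ concatUpTo n F
      ≡⟨ cong (λ m → ⟨ ∅t ⟩ ++ concatUpTo m F) 1+[n∸1]≡n ⟨
    ⟨ ∅t ⟩ ++ concatUpTo (suc (n ∸ 1)) F
      ≡⟨ cong (⟨ ∅t ⟩ ++_) (concatUpTo-suc (n ∸ 1) F) ⟩
    ⟨ ∅t ⟩ ++ interior t ++ ⟨ component t (suc (n ∸ 1)) ⟩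
      ≡⟨ cong (λ i → ⟨ ∅t ⟩ ++ interior t ++ ⟨ component t i ⟩) 1+[n∸1]≡n ⟩
    ⟨ ∅t ⟩ ++ interior t ++ ⟨ component t n ⟩
      ≡⟨ cong (λ p → ⟨ ∅t ⟩ ++ interior t ++ ⟨ p ⟩) (component-leaves t) ⟩
    ⟨ ∅t ⟩ ++ interior t ++ ⟨ just t , nothing ⟩ ∎
    where
    open ≡-Reasoning
    n = leaves t
    ∅t = nothing , just t
    F = ⟨_⟩ ∘ component t ∘ suc
    1+[n∸1]≡n : suc (n ∸ 1) ≡ n
    1+[n∸1]≡n = m+[n∸m]≡n (0<leaves t)

  Δ⊛bar-interior : ∀ t → Δ⊛bar t ∼ interior t
  Δ⊛bar-interior t = begin
    Δ⊛T t ++ (- 1# , ∅t) ∷ (- 1# , t∅) ∷ []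
      ≈⟨ ++⁺ (∼-trans (Δ⊛T-expansion t) (≡⇒∼ (expansion-split t))) ∼-refl ⟩
    ((1# , ∅t) ∷ interior t ++ ⟨ t∅ ⟩) ++ (- 1# , ∅t) ∷ (- 1# , t∅) ∷ []
      ≈⟨ ++-cancel ∅t (interior t ++ ⟨ t∅ ⟩) _ ⟩
    (interior t ++ ⟨ t∅ ⟩) ++ (- 1# , t∅) ∷ []
      ≡⟨ ++-assoc (interior t) _ _ ⟩
    interior t ++ (1# , t∅) ∷ (- 1# , t∅) ∷ []
      ≈⟨ ++⁺ ∼-refl (cancel t∅) ⟩
    interior t ++ []
      ≡⟨ ++-identityʳ _ ⟩
    interior t ∎
    where
    open ∼-Reasoning
    ∅t = nothing , just t
    t∅ = just t , nothing

  graftSum₁ : (ℕ → Basis²) → ℕ → PBT → Lin Basis²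
  graftSum₁ c k w = concatUpTo k (λ i → ⟨ graft₂ (k ∸ i) w (c i) ⟩)

  graftSum₂ : (ℕ → Basis²) → ℕ → PBT → Lin Basis²
  graftSum₂ c k w = compBoth (proj₁ (c k)) k (proj₂ (c (k ∸ 1))) 1 (Δ⊛bar w)

  graftSum₃ : (ℕ → Basis²) → ℕ → ℕ → PBT → Lin Basis²
  graftSum₃ c n k w = concatUpTo (suc n ∸ k) (λ j → ⟨ graft₁ k w (c (k + j)) ⟩)

  graftExpansion : (ℕ → Basis²) → ℕ → ℕ → PBT → Lin Basis²
  graftExpansion c n k w = graftSum₁ c k w ++ graftSum₂ c k w ++ graftSum₃ c n k w

  mapTerms-compBoth : ∀ (h : Basis² → Basis²) {a a′ b b′ : Basis} {j j′ m m′} xs →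
    (∀ x y → h (comp a j x , comp b m y) ≡ (comp a′ j′ x , comp b′ m′ y)) →
    mapTerms h (compBoth a j b m xs) ≡ compBoth a′ j′ b′ m′ xs
  mapTerms-compBoth h xs h-comp =
    trans (sym (map-∘ xs)) (map-cong (λ (k , (x , y)) → cong (k ,_) (h-comp x y)) xs)

  Δ⊛T-graft-leaf : ∀ w → Δ⊛T w ∼ graftExpansion (component leaf) 1 1 w
  Δ⊛T-graft-leaf w = begin
    Δ⊛T w                                     ≈⟨ Δ⊛T-expansion w ⟩
    expansion w                               ≡⟨ expansion-split w ⟩
    ⟨ ∅w ⟩ ++ interior w ++ ⟨ w∅ ⟩
      ≡⟨ cong (λ xs → ⟨ ∅w ⟩ ++ xs ++ ⟨ w∅ ⟩) interior-fixed ⟨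
    ⟨ ∅w ⟩ ++ mapTerms graftLeaf (interior w) ++ ⟨ w∅ ⟩
      ≈⟨ ++⁺ {xs = ⟨ ∅w ⟩} ∼-refl (++⁺ (mapTerms⁺ graftLeaf (∼-sym (Δ⊛bar-interior w))) ∼-refl) ⟩
    ⟨ ∅w ⟩ ++ mapTerms graftLeaf (Δ⊛bar w) ++ ⟨ w∅ ⟩ ∎
    where
    open ∼-Reasoning
    ∅w = nothing , just w
    w∅ = just w , nothing
    graftLeaf : Basis² → Basis²
    graftLeaf (x , y) = comp (just leaf) 1 x , comp (just leaf) 1 y
    interior-fixed : mapTerms graftLeaf (interior w) ≡ interior w
    interior-fixed = mapTerms-concatUpTo graftLeaf (leaves w ∸ 1) λ j j<n∸1 →
      let 1+j<n = subst (suc (suc j) ≤_) (m+[n∸m]≡n (0<leaves w)) (s≤s j<n∸1) in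
      cong₂ _,_ (comp-leaf (component₁-tree w z<s (<⇒≤ 1+j<n)))
                (comp-leaf (component₂-tree w 1+j<n))

  graftSum₁-node-≤ : ∀ {l} r w {k} → k ≤ leaves l →
    mapTerms (joinʳ r) (graftSum₁ (component l) k w) ≡ graftSum₁ (component (node l r)) k w
  graftSum₁-node-≤ {l} r w {k} k≤L =
    mapTerms-concatUpTo (joinʳ r) k {G = λ i → graft₂ (k ∸ i) w (component (node l r) i)} λ i i<k →
    let i<L = <-≤-trans i<k k≤L
        (x , y) = component l i
        k∸i≤y = subst (k ∸ i ≤_) (sym (deg-component₂ l (<⇒≤ i<L))) (∸-monoˡ-≤ i k≤L)
    in trans (cong (x ,_) (sym (comp-veeʳ-≤ {y} r (just w) (component₂-tree l i<L) k∸i≤y)))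
             (cong (graft₂ (k ∸ i) w) (sym (component-node-≤ r (<⇒≤ i<L))))

  graftSum₂-node-≤ : ∀ {l} r w {k} → 0 < k → k ≤ leaves l →
    mapTerms (joinʳ r) (graftSum₂ (component l) k w) ≡ graftSum₂ (component (node l r)) k w
  graftSum₂-node-≤ {l} r w {k} 0<k k≤L =
    mapTerms-compBoth (joinʳ r) {a = proj₁ (component l k)} {proj₁ (component (node l r) k)}
                      {b} {proj₂ (component (node l r) (k ∸ 1))} (Δ⊛bar w) λ x y →
    cong₂ _,_ (cong (λ a → comp a k x) (cong proj₁ (sym (component-node-≤ r k≤L))))
      (trans (sym (comp-veeʳ-≤ {b} r y 0<b 0<b))
             (cong (λ b → comp b 1 y) (cong proj₂ (sym (component-node-≤ r (<⇒≤ k∸1<L))))))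
    where
    k∸1<L : k ∸ 1 < leaves l
    k∸1<L = subst (_≤ leaves l) (sym (m+[n∸m]≡n 0<k)) k≤L
    b = proj₂ (component l (k ∸ 1))
    0<b : 0 < deg b
    0<b = component₂-tree l k∸1<L

  graftSum₃-node-≤ : ∀ l r w {k} → k ≤ leaves l →
    mapTerms (joinʳ r) (graftSum₃ (component l) (leaves l) k w)
      ++ mapTerms (joinˡ (graft l k w)) (concatUpTo (leaves r) (⟨_⟩ ∘ component r ∘ suc))
    ≡ graftSum₃ (component (node l r)) (leaves l + leaves r) k w
  graftSum₃-node-≤ l r w {k} k≤L = begin
    mapTerms (joinʳ r) (graftSum₃ (component l) L k w)
      ++ mapTerms (joinˡ (graft l k w)) (concatUpTo M (⟨_⟩ ∘ component r ∘ suc))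
      ≡⟨ cong₂ _++_
           (mapTerms-concatUpTo (joinʳ r) (suc L ∸ k) {G = G} λ j j< →
             cong (graft₁ k w) (sym (component-node-≤ r (k+j≤n k≤1+L j<))))
           (mapTerms-concatUpTo (joinˡ (graft l k w)) M {G = G ∘ (suc L ∸ k +_)} λ j j<M →
             sym (graft₁-right j j<M)) ⟩
    concatUpTo (suc L ∸ k) (⟨_⟩ ∘ G) ++ concatUpTo M (⟨_⟩ ∘ G ∘ (suc L ∸ k +_))
      ≡⟨ concatUpTo-+ (suc L ∸ k) M (⟨_⟩ ∘ G) ⟨
    concatUpTo (suc L ∸ k + M) (⟨_⟩ ∘ G)
      ≡⟨ cong (λ m → concatUpTo m (⟨_⟩ ∘ G)) (+-∸-comm M k≤1+L) ⟨
    graftSum₃ (component t) (L + M) k w ∎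
    where
    open ≡-Reasoning
    t = node l r
    L = leaves l
    M = leaves r
    k≤1+L = m≤n⇒m≤1+n k≤L
    G = λ j → graft₁ k w (component t (k + j))
    graft₁-right : ∀ j → j < M → G (suc L ∸ k + j) ≡ joinˡ (graft l k w) (component r (suc j))
    graft₁-right j j<M = let (x , y) = component r (suc j) in begin
      graft₁ k w (component t (k + (suc L ∸ k + j)))
        ≡⟨ cong (graft₁ k w ∘ component t) (m+[n∸m+o]≡n+o j k≤1+L) ⟩
      graft₁ k w (component t (suc L + j))
        ≡⟨ cong (graft₁ k w) (component-node-suc l r j) ⟩
      (comp (vee (just l) x) k (just w) , y)
        ≡⟨ cong (_, y) (comp-veeˡ-≤ l {x} w (component₁-tree r z<s j<M) k≤L) ⟩
      joinˡ (graft l k w) (x , y) ∎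

  Δ⊛T-graft-≤ : ∀ l r w {k} → 0 < k → k ≤ leaves l →
    Δ⊛T (graft l k w) ∼ graftExpansion (component l) (leaves l) k w →
    Δ⊛T (graft (node l r) k w) ∼ graftExpansion (component (node l r)) (leaves (node l r)) k w
  Δ⊛T-graft-≤ l r w {k} 0<k k≤L IH = begin
    Δ⊛T (graft (node l r) k w)
      ≡⟨ cong Δ⊛T (graft-node-≤ w k≤L) ⟩
    Δ⊛T (node (graft l k w) r)
      ≈⟨ Δ⊛T-node IH (∼-trans (Δ⊛T-expansion r) (≡⇒∼ (expansion-head r))) ⟩
    h (S₁ ++ S₂ ++ S₃) ++ Tʳ
      ≡⟨ cong (_++ Tʳ) (map-++₃ (map₂ (joinʳ r)) S₁ S₂ S₃) ⟩
    (h S₁ ++ h S₂ ++ h S₃) ++ Tʳ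
      ≡⟨ trans (++-assoc (h S₁) (h S₂ ++ h S₃) Tʳ) (cong (h S₁ ++_) (++-assoc (h S₂) (h S₃) Tʳ)) ⟩
    h S₁ ++ h S₂ ++ h S₃ ++ Tʳ
      ≡⟨ cong₂ _++_ (graftSum₁-node-≤ r w k≤L)
           (cong₂ _++_ (graftSum₂-node-≤ r w 0<k k≤L) (graftSum₃-node-≤ l r w k≤L)) ⟩
    graftExpansion (component (node l r)) (leaves (node l r)) k w ∎
    where
    open ∼-Reasoning
    h = mapTerms (joinʳ r)
    S₁ = graftSum₁ (component l) k w
    S₂ = graftSum₂ (component l) k w
    S₃ = graftSum₃ (component l) (leaves l) k w
    Tʳ = mapTerms (joinˡ (graft l k w)) (concatUpTo (leaves r) (⟨_⟩ ∘ component r ∘ suc))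

  graftSum₁-node-+ : ∀ l r w j →
    mapTerms (joinʳ (graft r (suc j) w)) (expansion l)
      ++ mapTerms (joinˡ l) (concatUpTo j (λ i → ⟨ graft₂ (j ∸ i) w (component r (suc i)) ⟩))
    ≡ graftSum₁ (component (node l r)) (leaves l + suc j) w
  graftSum₁-node-+ l r w j = begin
    mapTerms (joinʳ (graft r (suc j) w)) (expansion l)
      ++ mapTerms (joinˡ l) (concatUpTo j (λ i → ⟨ graft₂ (j ∸ i) w (component r (suc i)) ⟩))
      ≡⟨ cong₂ _++_
           (mapTerms-concatUpTo (joinʳ (graft r (suc j) w)) (suc L) {G = G} λ i i≤L →
             sym (graft₂-left i (s≤s⁻¹ i≤L)))
           (mapTerms-concatUpTo (joinˡ l) j {G = G ∘ (suc L +_)} λ i _ →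
             sym (cong₂ (λ m p → graft₂ m w p) (shift i) (component-node-suc l r i))) ⟩
    concatUpTo (suc L) (⟨_⟩ ∘ G) ++ concatUpTo j (⟨_⟩ ∘ G ∘ (suc L +_))
      ≡⟨ concatUpTo-+ (suc L) j (⟨_⟩ ∘ G) ⟨
    concatUpTo (suc L + j) (⟨_⟩ ∘ G)
      ≡⟨ cong (λ m → concatUpTo m (⟨_⟩ ∘ G)) (+-suc L j) ⟨
    graftSum₁ (component t) k w ∎
    where
    open ≡-Reasoning
    t = node l r
    L = leaves l
    k = L + suc j
    G = λ i → graft₂ (k ∸ i) w (component t i)
    shift : ∀ i → k ∸ suc (L + i) ≡ j ∸ i
    shift i = trans (cong (_∸ suc (L + i)) (+-suc L j)) ([m+n]∸[m+o]≡n∸o L j i)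
    graft₂-left : ∀ i → i ≤ L → G i ≡ joinʳ (graft r (suc j) w) (component l i)
    graft₂-left i i≤L = let (x , y) = component l i in begin
      graft₂ (k ∸ i) w (component t i)
        ≡⟨ cong (graft₂ (k ∸ i) w) (component-node-≤ r i≤L) ⟩
      (x , comp (vee y (just r)) (k ∸ i) (just w))
        ≡⟨ cong (λ m → x , comp (vee y (just r)) m (just w))
             (trans (+-∸-comm (suc j) i≤L) (cong (_+ suc j) (sym (deg-component₂ l i≤L)))) ⟩
      (x , comp (vee y (just r)) (deg y + suc j) (just w))
        ≡⟨ cong (x ,_) (comp-veeʳ-+ y r j w) ⟩
      joinʳ (graft r (suc j) w) (x , y) ∎

  graftSum₂-node-+ : ∀ l r w j → suc j ≤ leaves r →
    mapTerms (joinˡ l) (graftSum₂ (component r) (suc j) w)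
    ≡ graftSum₂ (component (node l r)) (leaves l + suc j) w
  graftSum₂-node-+ l r w j 1+j≤M =
    mapTerms-compBoth (joinˡ l) {a = a} {proj₁ (component t k)} {b} {proj₂ (component t (k ∸ 1))}
                      (Δ⊛bar w) λ x y →
    sym (cong₂ _,_
      (trans (cong (λ a → comp a k x) (cong proj₁ (component-node-+ l r (suc j))))
             (comp-veeˡ-+ l {a} j x (component₁-tree r z<s 1+j≤M)))
      (cong (λ b → comp b 1 y)
        (cong proj₂ (trans (cong (component t ∘ (_∸ 1)) (+-suc (leaves l) j))
                           (component-node-+ l r j)))))
    where
    t = node l r
    k = leaves l + suc j
    a = proj₁ (component r (suc j))
    b = proj₂ (component r j)

  graftSum₃-node-+ : ∀ l r w j → suc j ≤ leaves r →
    mapTerms (joinˡ l) (graftSum₃ (component r) (leaves r) (suc j) w)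
    ≡ graftSum₃ (component (node l r)) (leaves l + leaves r) (leaves l + suc j) w
  graftSum₃-node-+ l r w j 1+j≤M = trans
    (mapTerms-concatUpTo (joinˡ l) (suc M ∸ suc j) {G = G} λ i i< → sym (graft₁-right i i<))
    (cong (λ m → concatUpTo m (⟨_⟩ ∘ G))
      (sym (trans (cong (_∸ k) (sym (+-suc L M))) ([m+n]∸[m+o]≡n∸o L (suc M) (suc j)))))
    where
    open ≡-Reasoning
    t = node l r
    L = leaves l
    M = leaves r
    k = L + suc j
    G = λ i → graft₁ k w (component t (k + i))
    graft₁-right : ∀ i → i < suc M ∸ suc j →
                   G i ≡ joinˡ l (graft₁ (suc j) w (component r (suc j + i)))
    graft₁-right i i< = let (x , y) = component r (suc j + i) in begin
      graft₁ k w (component t (L + suc j + i))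
        ≡⟨ cong (graft₁ k w ∘ component t) (+-assoc L (suc j) i) ⟩
      graft₁ k w (component t (L + (suc j + i)))
        ≡⟨ cong (graft₁ k w) (component-node-+ l r (suc j + i)) ⟩
      (comp (vee (just l) x) k (just w) , y)
        ≡⟨ cong (_, y) (comp-veeˡ-+ l {x} j (just w)
             (component₁-tree r z<s (k+j≤n (m≤n⇒m≤1+n 1+j≤M) i<))) ⟩
      joinˡ l (graft₁ (suc j) w (x , y)) ∎

  Δ⊛T-graft-+ : ∀ l r w j → suc j ≤ leaves r →
    Δ⊛T (graft r (suc j) w) ∼ graftExpansion (component r) (leaves r) (suc j) w →
    Δ⊛T (graft (node l r) (leaves l + suc j) w)
      ∼ graftExpansion (component (node l r)) (leaves (node l r)) (leaves l + suc j) w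
  Δ⊛T-graft-+ l r w j 1+j≤M IH = begin
    Δ⊛T (graft (node l r) (leaves l + suc j) w)
      ≡⟨ cong Δ⊛T (graft-node-+ l r j w) ⟩
    Δ⊛T (node l r′)
      ≈⟨ Δ⊛T-node (Δ⊛T-expansion l) (∼-trans IH (≡⇒∼ head)) ⟩
    E ++ h (T₁ ++ S₂ ++ S₃)
      ≡⟨ cong (E ++_) (map-++₃ (map₂ (joinˡ l)) T₁ S₂ S₃) ⟩
    E ++ h T₁ ++ h S₂ ++ h S₃
      ≡⟨ ++-assoc E (h T₁) (h S₂ ++ h S₃) ⟨
    (E ++ h T₁) ++ h S₂ ++ h S₃
      ≡⟨ cong₂ _++_ (graftSum₁-node-+ l r w j)
           (cong₂ _++_ (graftSum₂-node-+ l r w j 1+j≤M) (graftSum₃-node-+ l r w j 1+j≤M)) ⟩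
    graftExpansion (component (node l r)) (leaves (node l r)) (leaves l + suc j) w ∎
    where
    open ∼-Reasoning
    r′ = graft r (suc j) w
    h = mapTerms (joinˡ l)
    E = mapTerms (joinʳ r′) (expansion l)
    T₁ = concatUpTo j (λ i → ⟨ graft₂ (j ∸ i) w (component r (suc i)) ⟩)
    S₂ = graftSum₂ (component r) (suc j) w
    S₃ = graftSum₃ (component r) (leaves r) (suc j) w
    head : graftExpansion (component r) (leaves r) (suc j) w
           ≡ ⟨ nothing , just r′ ⟩ ++ T₁ ++ S₂ ++ S₃
    head = cong (λ p → ⟨ graft₂ (suc j) w p ⟩ ++ T₁ ++ S₂ ++ S₃) (component-zero r)

  Δ⊛T-graft : ∀ t w {k} → 0 < k → k ≤ leaves t →
              Δ⊛T (graft t k w) ∼ graftExpansion (component t) (leaves t) k w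
  Δ⊛T-graft leaf       w {suc zero}    _ _         = Δ⊛T-graft-leaf w
  Δ⊛T-graft leaf       w {suc (suc _)} _ (s≤s ())
  Δ⊛T-graft (node l r) w {k} 0<k k≤n with ≤⊎≡+suc k (leaves l)
  ... | inj₁ k≤L       = Δ⊛T-graft-≤ l r w 0<k k≤L (Δ⊛T-graft l w 0<k k≤L)
  ... | inj₂ (j , refl) = Δ⊛T-graft-+ l r w j 1+j≤M (Δ⊛T-graft r w z<s 1+j≤M)
    where
    1+j≤M : suc j ≤ leaves r
    1+j≤M = +-cancelˡ-≤ (leaves l) (suc j) (leaves r) k≤n

  Σ-as-concatUpTo : ∀ lo hi f → Σ[ lo ≤i≤ hi ] f ≡ concatUpTo (suc hi ∸ lo) (f ∘ (lo +_))
  Σ-as-concatUpTo lo hi f = cong concat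
    (trans (cong (map f) (map-applyUpTo (λ i → i) (lo +_) m)) (map-applyUpTo (lo +_) f m))
    where m = suc hi ∸ lo

  Σ-graftExpansion : ∀ n w {k} (a b : ℕ → Basis) → 0 < k →
    Σ[ 0 ≤i≤ k ∸ 1 ] (λ i → [ a i ⊗ comp (b i) (k ∸ i) (just w) ])
      ++ compBoth (a k) k (b (k ∸ 1)) 1 (Δ⊛bar w)
      ++ Σ[ k ≤i≤ n ] (λ i → [ comp (a i) k (just w) ⊗ b i ])
    ≡ graftExpansion (λ i → a i , b i) n k w
  Σ-graftExpansion n w {k} a b 0<k = cong₂ _++_
    (trans (Σ-as-concatUpTo 0 (k ∸ 1) F₁) (cong (λ m → concatUpTo m F₁) (m+[n∸m]≡n 0<k)))
    (cong (compBoth (a k) k (b (k ∸ 1)) 1 (Δ⊛bar w) ++_) (Σ-as-concatUpTo k n F₃))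
    where
    F₁ = λ i → [ a i ⊗ comp (b i) (k ∸ i) (just w) ]
    F₃ = λ i → [ comp (a i) k (just w) ⊗ b i ]

  graftExpansion-cong : ∀ {c c′ : ℕ → Basis²} n w {k} → k ≤ n →
                        (∀ i → i ≤ n → c i ≡ c′ i) →
                        graftExpansion c n k w ≡ graftExpansion c′ n k w
  graftExpansion-cong n w {k} k≤n c≡c′ = cong₂ _++_
    (concatUpTo-cong k λ i i<k →
      cong (λ p → ⟨ graft₂ (k ∸ i) w p ⟩) (c≡c′ i (<⇒≤ (<-≤-trans i<k k≤n))))
    (cong₂ _++_
      (cong₂ (λ a b → compBoth a k b 1 (Δ⊛bar w))
        (cong proj₁ (c≡c′ k k≤n)) (cong proj₂ (c≡c′ (k ∸ 1) (≤-trans (m∸n≤m k 1) k≤n))))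
      (concatUpTo-cong (suc n ∸ k) λ j j< →
        cong (λ p → ⟨ graft₁ k w p ⟩) (c≡c′ (k + j) (k+j≤n (m≤n⇒m≤1+n k≤n) j<))))

  -- If (a i , b i) differs from component t i, the coefficient of component t i is 1 in
  -- Δ⊛T t but 0 in Σ a j ⊗ b j, since deg (a j) = j.
  component-or-trivial : ∀ t (a b : ℕ → Basis) → (∀ i → i ≤ leaves t → deg (a i) ≡ i) →
    Δ⊛T t ≋ Σ[ 0 ≤i≤ leaves t ] (λ i → [ a i ⊗ b i ]) →
    ∀ i → i ≤ leaves t → (a i , b i) ≡ component t i ⊎ 1# ≈ 0#
  component-or-trivial t a b deg-a Δt≋ i i≤n with (a i , b i) ≟B² component t i
  ... | yes ab≡c = inj₁ ab≡c
  ... | no  ab≢c = inj₂ (begin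
    1#
      ≈⟨ coeff-concatUpTo-unique _≟B²_ (suc n) (component t) (s≤s i≤n) refl only-i ⟨
    coeff _≟B²_ q (expansion t)                    ≈⟨ ∼⇒≋ (Δ⊛T-expansion t) q ⟨
    coeff _≟B²_ q (Δ⊛T t)                          ≈⟨ Δt≋ q ⟩
    coeff _≟B²_ q (Σ[ 0 ≤i≤ n ] (⟨_⟩ ∘ ab))        ≡⟨ cong (coeff _≟B²_ q) (Σ-as-concatUpTo 0 n (⟨_⟩ ∘ ab)) ⟩
    coeff _≟B²_ q (concatUpTo (suc n) (⟨_⟩ ∘ ab))  ≈⟨ coeff-concatUpTo-∉ _≟B²_ (suc n) ab absent ⟩
    0#                                             ∎)
    where
    open SetoidReasoning (CommutativeRing.setoid R)
    n = leaves t
    q = component t i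
    ab = λ j → a j , b j
    same-degree : ∀ {j} {p : Basis²} → j ≤ n → deg (proj₁ p) ≡ j → p ≡ q → j ≡ i
    same-degree j≤n deg≡j refl = trans (sym deg≡j) (deg-component₁ t i≤n)
    only-i : ∀ j → j < suc n → component t j ≡ q → j ≡ i
    only-i j j≤n = same-degree (s≤s⁻¹ j≤n) (deg-component₁ t (s≤s⁻¹ j≤n))
    absent : ∀ j → j < suc n → ab j ≢ q
    absent j j≤n abj≡q =
      ab≢c (subst (λ m → ab m ≡ q) (same-degree (s≤s⁻¹ j≤n) (deg-a j (s≤s⁻¹ j≤n)) abj≡q) abj≡q)

proposition2p27 : {c ℓ : Level} (R : CommutativeRing c ℓ) → let open Over R in
  (n : ℕ) (t : PBT) → leaves t ≡ n →
  (w : PBT) (k : ℕ) → 1 ≤ k → k ≤ n →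
  (a b : ℕ → Basis) →
  (∀ i → i ≤ n → deg (a i) ≡ i) →
  (∀ i → i ≤ n → deg (b i) ≡ n ∸ i) →
  Δ⊛T t ≋ Σ[ 0 ≤i≤ n ] (λ i → [ a i ⊗ b i ]) →
  Δ⊛T (graft t k w) ≋
    (Σ[ 0 ≤i≤ k ∸ 1 ] (λ i → [ a i ⊗ comp (b i) (k ∸ i) (just w) ])
     ++ compBoth (a k) k (b (k ∸ 1)) 1 (Δ⊛bar w)
     ++ Σ[ k ≤i≤ n ] (λ i → [ comp (a i) k (just w) ⊗ b i ]))
proposition2p27 R n t refl w k 0<k k≤n a b deg-a _ Δt≋ =
  [ (λ same → subst (Δ⊛T (graft t k w) ≋_)
                (sym (trans (Σ-graftExpansion n w a b 0<k) (graftExpansion-cong n w k≤n same)))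
                (∼⇒≋ (Δ⊛T-graft t w 0<k k≤n)))
  , (λ 1≈0 q → 1≈0⇒≈ 1≈0 _ _)
  ]′ (all-or-⊎ n (component-or-trivial t a b deg-a Δt≋))
  where open Over R; open FormalSums R; open GraftCoproduct R
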